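{- Let $A$ be a commutative ring with identity and $HA$ the ring of Hurwitz series over $A$. Let $n\in\mathbb{N}^+$ be fixed, $z_0,\dots,z_{n-1}\in HA$ and $z=\mathrm{intl}(z_0,\dots,z_{n-1})$. Then $$\langle 1\rangle\, z=\mathrm{intl}\Big(\int(n_n\boxdot z_{n-1}),\ 1_n\boxdot z_0,\ \dots,\ (i+1)_n\boxdot z_i,\ \dots,\ (n-1)_n\boxdot z_{n-2}\Big).$$
   Context: $HA$ is the set of sequences $f=(f(0),f(1),\dots)$ with entries in $A$, with componentwise addition and product $(fg)(m)=\sum_{i=0}^m\binom{m}{i}f(i)g(m-i)$. The integral is $\int f=(0,f(0),f(1),\dots)$. $\langle 1\rangle=(0,1,0,0,\dots)$. For fixed $n$, $\widehat{q}=\lfloor q/n\rfloor$, $\overline{q}=q-\widehat{q}n$; the interlacing is $\mathrm{intl}(z_0,\dots,z_{n-1})(q)=z_{\overline{q}}(\widehat{q})$. The Hadamard product is $(f\boxdot g)(p)=f(p)g(p)$. For $1\le\tau\le n$, $\tau_n\in HA$ is defined by $\tau_n(k)=kn+\tau$, so $(\tau_n\boxdot f)(k)=(kn+\tau)f(k)$. -}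

module Defs where

open import Level using (Level)
open import Algebra.Bundles using (CommutativeRing)
open import Data.Nat using (ℕ; zero; suc; _∸_; NonZero) renaming (_*_ to _*ℕ_; _+_ to _+ℕ_)
open import Data.Nat.DivMod using (_/_; _mod_)
open import Data.Nat.Combinatorics using (_C_)
open import Data.Fin using (Fin; zero; suc; toℕ; fromℕ; inject₁)

module Hurwitz {c ℓ : Level} (R : CommutativeRing c ℓ) where
  open CommutativeRing R
  open import Algebra.Definitions.RawMonoid +-rawMonoid using (_×_)

  HA : Set c
  HA = ℕ → Carrier

  _≋_ : HA → HA → Set ℓ
  f ≋ g = ∀ q → f q ≈ g q

  sumTo : ℕ → (ℕ → Carrier) → Carrier
  sumTo zero    f = 0#
  sumTo (suc m) f = sumTo m f + f m

  _⊙_ : HA → HA → HA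
  (f ⊙ g) m = sumTo (suc m) (λ i → (m C i) × (f i * g (m ∸ i)))

  ∫ : HA → HA
  ∫ f zero    = 0#
  ∫ f (suc k) = f k

  ⟨1⟩ : HA
  ⟨1⟩ 1 = 1#
  ⟨1⟩ _ = 0#

  _⊡_ : HA → HA → HA
  (f ⊡ g) p = f p * g p

  τ[_]_ : ℕ → ℕ → HA
  (τ[ n ] τ) k = ((k *ℕ n) +ℕ τ) × 1#

  intl : (n : ℕ) .{{_ : NonZero n}} → (Fin n → HA) → HA
  intl n z q = z (q mod n) (q / n)

  rhsFamily : (m : ℕ) → (Fin (suc m) → HA) → Fin (suc m) → HA
  rhsFamily m z zero    = ∫ ((τ[ suc m ] suc m) ⊡ z (fromℕ m))
  rhsFamily m z (suc i) = (τ[ suc m ] suc (toℕ i)) ⊡ z (inject₁ i)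

-- Since ⟨1⟩ is supported at 1 and binom(p + 1, 1) = p + 1, multiplying by ⟨1⟩ shifts
-- a Hurwitz series and weights it by the index: (⟨1⟩ f)(0) = 0 and
-- (⟨1⟩ f)(p + 1) = (p + 1) f(p).  Write q = j + k n with j < n.  For j = i + 1 the entry
-- q - 1 = i + k n of intl(z) is z_i(k), with weight k n + (i + 1); for j = 0, k ≥ 1 it is
-- z_{n-1}(k - 1), with weight (k - 1) n + n.  These are the entries of the right-hand family.
module Submission where

open import Defs
open import Level using (Level)
open import Algebra.Bundles using (CommutativeRing)
open import Data.Nat using (ℕ; zero; suc; NonZero; _+_; _*_; _∸_)
open import Data.Nat.Properties using (+-comm; +-suc)
open import Data.Nat.DivMod
open import Data.Nat.Divisibility using (n∣m*n)
open import Data.Nat.Combinatorics using (_C_; nC1≡n)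
open import Data.Fin using (Fin; zero; suc; toℕ; fromℕ; inject₁)
open import Data.Fin.Properties using (toℕ-injective; toℕ-fromℕ<; toℕ<n; toℕ-fromℕ; toℕ-inject₁)
open import Relation.Binary.PropositionalEquality as ≡ using (_≡_; cong; cong₂; subst)

module _ {n : ℕ} .{{_ : NonZero n}} where

  [j+kn]mod-n≡j : (j : Fin n) (k : ℕ) → (toℕ j + k * n) mod n ≡ j
  [j+kn]mod-n≡j j k = toℕ-injective (begin
    toℕ ((toℕ j + k * n) mod n) ≡⟨ toℕ-fromℕ< _ ⟩
    (toℕ j + k * n) % n         ≡⟨ [m+kn]%n≡m%n (toℕ j) k n ⟩
    toℕ j % n                   ≡⟨ m<n⇒m%n≡m (toℕ<n j) ⟩
    toℕ j                       ∎)
    where open ≡.≡-Reasoning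

  [j+kn]/n≡k : (j : Fin n) (k : ℕ) → (toℕ j + k * n) / n ≡ k
  [j+kn]/n≡k j k = begin
    (toℕ j + k * n) / n     ≡⟨ +-distrib-/-∣ʳ (toℕ j) (n∣m*n k) ⟩
    toℕ j / n + k * n / n   ≡⟨ cong₂ _+_ (m<n⇒m/n≡0 (toℕ<n j)) (m*n/n≡m k n) ⟩
    k                       ∎
    where open ≡.≡-Reasoning

module _ {c ℓ : Level} (R : CommutativeRing c ℓ) where
  open CommutativeRing R
    using (Carrier; _≈_; 0#; 1#; sym; trans; +-congˡ; +-congʳ; +-identityˡ; +-identityʳ;
           *-identityˡ; zeroˡ; setoid; semiring)
    renaming (_*_ to _*ᴿ_)
  open Hurwitz R
  open import Algebra.Properties.Semiring.Mult semiring using (_×_; ×-congʳ; ×-assoc-*; ×-comm-*)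
  open import Relation.Binary.Reasoning.Setoid setoid

  ×1#-* : ∀ k x → (k × 1#) *ᴿ x ≈ k × x
  ×1#-* k x = trans (×-assoc-* k 1# x) (×-congʳ k (*-identityˡ x))

  ×-zeroˡ-* : ∀ k x → k × (0# *ᴿ x) ≈ 0#
  ×-zeroˡ-* k x = trans (sym (×-comm-* k 0# x)) (zeroˡ (k × x))

  sumTo-supported-at-1 : ∀ j (h : ℕ → Carrier) → h 0 ≈ 0# → (∀ i → h (suc (suc i)) ≈ 0#) →
                         sumTo (suc (suc j)) h ≈ h 1
  sumTo-supported-at-1 zero    h h0≈0 _     = trans (+-congʳ (trans (+-identityˡ _) h0≈0)) (+-identityˡ _)
  sumTo-supported-at-1 (suc j) h h0≈0 h2+≈0 =
    trans (+-congˡ (h2+≈0 j)) (trans (+-identityʳ _) (sumTo-supported-at-1 j h h0≈0 h2+≈0))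

  ⟨1⟩⊙-zero : ∀ f → (⟨1⟩ ⊙ f) 0 ≈ 0#
  ⟨1⟩⊙-zero f = trans (+-identityˡ _) (×-zeroˡ-* 1 (f 0))

  ⟨1⟩⊙-suc : ∀ f p → (⟨1⟩ ⊙ f) (suc p) ≈ suc p × f p
  ⟨1⟩⊙-suc f p = begin
    (⟨1⟩ ⊙ f) (suc p)          ≈⟨ sumTo-supported-at-1 p summand vanishes-at-0 vanishes-from-2 ⟩
    (suc p C 1) × (1# *ᴿ f p)  ≈⟨ ×-congʳ (suc p C 1) (*-identityˡ (f p)) ⟩
    (suc p C 1) × f p          ≡⟨ cong (_× f p) (nC1≡n (suc p)) ⟩
    suc p × f p                ∎
    where
    summand : ℕ → Carrier
    summand i = (suc p C i) × (⟨1⟩ i *ᴿ f (suc p ∸ i))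
    vanishes-at-0 : summand 0 ≈ 0#
    vanishes-at-0 = ×-zeroˡ-* (suc p C 0) (f (suc p))
    vanishes-from-2 : ∀ i → summand (suc (suc i)) ≈ 0#
    vanishes-from-2 i = ×-zeroˡ-* (suc p C suc (suc i)) (f (p ∸ suc i))

  module _ {n : ℕ} .{{_ : NonZero n}} where

    intl-+* : (z : Fin n → HA) (j : Fin n) (k : ℕ) → intl n z (toℕ j + k * n) ≡ z j k
    intl-+* z j k = cong₂ z ([j+kn]mod-n≡j j k) ([j+kn]/n≡k j k)

    ⟨1⟩⊙intl-suc : (z : Fin n → HA) (j : Fin n) {t : ℕ} (k : ℕ) → toℕ j ≡ t →
                   (⟨1⟩ ⊙ intl n z) (suc (t + k * n)) ≈ (τ[ n ] suc t) k *ᴿ z j k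
    ⟨1⟩⊙intl-suc z j {t} k ≡.refl = begin
      (⟨1⟩ ⊙ intl n z) (suc (t + k * n))     ≈⟨ ⟨1⟩⊙-suc (intl n z) (t + k * n) ⟩
      suc (t + k * n) × intl n z (t + k * n) ≡⟨ cong₂ _×_ weight (intl-+* z j k) ⟩
      (k * n + suc t) × z j k                ≈⟨ ×1#-* (k * n + suc t) (z j k) ⟨
      (τ[ n ] suc t) k *ᴿ z j k              ∎
      where
      weight : suc (t + k * n) ≡ k * n + suc t
      weight = ≡.sym (≡.trans (+-suc (k * n) t) (cong suc (+-comm (k * n) t)))

lemma3p4 : {c ℓ : Level} (R : CommutativeRing c ℓ) (m : ℕ)
    → let open Hurwitz R in
    (z : Fin (suc m) → HA)
    → (⟨1⟩ ⊙ intl (suc m) z) ≋ intl (suc m) (rhsFamily m z)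
lemma3p4 R m z q =
  subst (λ q → (⟨1⟩ ⊙ intl n z) q ≈ intl n w q) (≡.sym (DivMod.property (q divMod n)))
        (trans (at (q mod n) (q / n)) (reflexive (≡.sym (intl-+* R w (q mod n) (q / n)))))
  where
  open CommutativeRing R using (_≈_; trans; reflexive)
  open Hurwitz R
  n : ℕ
  n = suc m
  w : Fin n → HA
  w = rhsFamily m z
  at : (j : Fin n) (k : ℕ) → (⟨1⟩ ⊙ intl n z) (toℕ j + k * n) ≈ w j k
  at zero    zero    = ⟨1⟩⊙-zero R (intl n z)
  at zero    (suc k) = ⟨1⟩⊙intl-suc R z (fromℕ m) k (toℕ-fromℕ m)
  at (suc i) k       = ⟨1⟩⊙intl-suc R z (inject₁ i) k (toℕ-inject₁ i)
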